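{- Let $\lambda_1,\lambda_2 \in \mathbb{N}$ be two coprime positive integers such that $\lambda_1 \equiv \lambda_2-1 \pmod 3$, and let $S=\{0,\lambda_1,\lambda_1+\lambda_2\}$. Let $A\subset \mathbb{Z}$ be an $S$-packing set. For $t\in \mathbb{Z}$, let $I_1(t)=\{t+1,\dots,t+2\lambda_1+\lambda_2\}$ and $I_2(t)=\{t+\lambda_1+\lambda_2+1,\dots,t+3\lambda_1+2\lambda_2\}$. Then for every $t\in\mathbb{Z}$, \[ 2|I_1(t)\setminus A|+|I_2(t)\setminus A|\geq 4\lambda_1+2\lambda_2. \]
   Context: For $t\in\mathbb{Z}$, $S+t=\{s+t:s\in S\}$. A set $A\subset\mathbb{Z}$ is $S$-packing if $S+a_1$ and $S+a_2$ are disjoint for all distinct $a_1,a_2\in A$. -}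

module Defs where

open import Data.Nat using (ℕ; zero; suc; _*_) renaming (_+_ to _+ℕ_)
open import Data.Integer using (ℤ; +_; _+_)
open import Data.Bool using (Bool; true; false; not)
open import Data.List using (List; []; _∷_; filter; length)
open import Data.List.Membership.Propositional using (_∈_)
open import Relation.Binary.PropositionalEquality using (_≡_; _≢_)
open import Relation.Nullary using (¬_)
open import Data.Bool.Properties using (T?)
open import Data.Product using (_×_)

-- A subset of ℤ, given by its (classically always decidable) membership test.
SubsetZ : Set
SubsetZ = ℤ → Bool

Disjoint+ : List ℤ → ℤ → ℤ → Set
Disjoint+ S t t' = ∀ {s s'} → s ∈ S → s' ∈ S → s + t ≢ s' + t'

Packing : List ℤ → SubsetZ → Set
Packing S A = ∀ a₁ a₂ → A a₁ ≡ true → A a₂ ≡ true → a₁ ≢ a₂ → Disjoint+ S a₁ a₂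

range : ℤ → ℕ → List ℤ
range t zero = []
range t (suc n) = (t + + 1) ∷ range (t + + 1) n

S₃ : ℕ → ℕ → List ℤ
S₃ λ₁ λ₂ = + 0 ∷ + λ₁ ∷ + (λ₁ +ℕ λ₂) ∷ []

I₁ : ℕ → ℕ → ℤ → List ℤ
I₁ λ₁ λ₂ t = range t (2 * λ₁ +ℕ λ₂)

I₂ : ℕ → ℕ → ℤ → List ℤ
I₂ λ₁ λ₂ t = range (t + + (λ₁ +ℕ λ₂)) ((3 * λ₁ +ℕ 2 * λ₂) Data.Nat.∸ (λ₁ +ℕ λ₂))

-- |I \ A| (the list I has no repetitions)
missing : List ℤ → SubsetZ → ℕ
missing I A = length (filter (λ x → T? (not (A x))) I)

-- An S-packing set has no two points at distance λ₁, λ₂ or λ₁+λ₂, hence at most one point of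
-- each triple {x, x+λ₁, x+λ₁+λ₂} or {x, x+λ₂, x+λ₁+λ₂}. Summed over a window of length ℓ, the
-- translates of the window by the three offsets of such a triple contain at most ℓ points of A.
-- Cut I₁(t) at t+λ₂ (or at t+λ₁) and at u = t+λ₁+λ₂, and I₂(t) at u+λ₂ and u+λ₁+λ₂: the pieces
-- of two copies of I₁(t) and one of I₂(t) form three such families, of lengths λ₂, λ₁ and λ₁.
-- Hence 2|I₁(t) ∩ A| + |I₂(t) ∩ A| ≤ 2λ₁+λ₂, which is the claim after complementing.
{-# OPTIONS --safe #-}
module Submission where

open import Defs
open import Data.Nat using (ℕ; _+_; _*_; _≤_; _∸_; _%_; NonZero)
open import Data.Nat.Coprimality using (Coprime)
open import Data.Integer using (ℤ)
open import Relation.Binary.PropositionalEquality using (_≡_)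

open import Data.Nat using (zero; suc; _<_; z≤n; s≤s)
open import Data.Nat.Properties
  using (+-suc; +-assoc; +-comm; +-mono-≤; +-monoˡ-≤; +-cancelˡ-≤; m+n∸n≡m; m≤m+n; ≤-trans; module ≤-Reasoning)
open import Data.Nat.Tactic.RingSolver using (solve-∀; solve)
open import Data.List using (_∷_; [])
open import Data.Integer as ℤ using (+_)
import Data.Integer.Properties as ℤ
open import Algebra.Properties.CommutativeSemigroup ℤ.+-commutativeSemigroup using (xy∙z≈x∙zy; xy∙z≈xz∙y)
open import Data.Bool using (Bool; true; false)
open import Data.Empty using (⊥; ⊥-elim)
open import Data.List.Relation.Unary.Any using (here; there)
open import Data.List.Membership.Propositional using (_∈_)
open import Relation.Binary.PropositionalEquality using (_≢_; refl; sym; trans; cong; cong₂; module ≡-Reasoning)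

indicator : Bool → ℕ
indicator true  = 1
indicator false = 0

count : SubsetZ → ℤ → ℕ → ℕ
count A t zero    = 0
count A t (suc n) = indicator (A (t ℤ.+ + 1)) + count A (t ℤ.+ + 1) n

count+missing : ∀ A t n → count A t n + missing (range t n) A ≡ n
count+missing A t zero = refl
count+missing A t (suc n) with A (t ℤ.+ + 1) | count+missing A (t ℤ.+ + 1) n
... | true  | ih = cong suc ih
... | false | ih = trans (+-suc _ _) (cong suc ih)

+-pos-+ : ∀ x m n → x ℤ.+ + (m + n) ≡ x ℤ.+ + m ℤ.+ + n
+-pos-+ x m n = trans (cong (ℤ._+_ x) (ℤ.pos-+ m n)) (sym (ℤ.+-assoc x (+ m) (+ n)))

count-+ : ∀ A t m n → count A t (m + n) ≡ count A t m + count A (t ℤ.+ + m) n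
count-+ A t zero n = cong (λ s → count A s n) (sym (ℤ.+-identityʳ t))
count-+ A t (suc m) n = begin
  indicator (A t₁) + count A t₁ (m + n)
    ≡⟨ cong (_+_ (indicator (A t₁))) (count-+ A t₁ m n) ⟩
  indicator (A t₁) + (count A t₁ m + count A (t₁ ℤ.+ + m) n)
    ≡⟨ cong (λ s → indicator (A t₁) + (count A t₁ m + count A s n)) (sym (+-pos-+ t 1 m)) ⟩
  indicator (A t₁) + (count A t₁ m + count A (t ℤ.+ + suc m) n)
    ≡⟨ sym (+-assoc (indicator (A t₁)) _ _) ⟩
  count A t (suc m) + count A (t ℤ.+ + suc m) n ∎
  where
  open ≡-Reasoning
  t₁ = t ℤ.+ + 1

AvoidsGap : SubsetZ → ℕ → Set
AvoidsGap A d = ∀ x → A x ≡ true → A (x ℤ.+ + d) ≡ true → ⊥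

packing⇒avoidsGap : ∀ {S A s s' d} → Packing S A → s ∈ S → s' ∈ S →
                    s ≡ s' ℤ.+ + d → 0 < d → AvoidsGap A d
packing⇒avoidsGap {s = s} {s'} {d} packing s∈S s'∈S s≡s'+d 0<d x Ax Ax+d =
  packing x (x ℤ.+ + d) Ax Ax+d x≢x+d s∈S s'∈S translates
  where
  x≢x+d : x ≢ x ℤ.+ + d
  x≢x+d x≡x+d = ℤ.<⇒≢ (ℤ.+-monoʳ-< x (ℤ.+<+ 0<d)) (trans (ℤ.+-identityʳ x) x≡x+d)
  translates : s ℤ.+ x ≡ s' ℤ.+ (x ℤ.+ + d)
  translates = trans (cong (ℤ._+ x) s≡s'+d) (xy∙z≈x∙zy s' (+ d) x)

at-most-one-of-three : ∀ {A d e f} → AvoidsGap A d → AvoidsGap A e → AvoidsGap A f → d + e ≡ f →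
                       ∀ x → indicator (A x) + indicator (A (x ℤ.+ + d)) + indicator (A (x ℤ.+ + f)) ≤ 1
at-most-one-of-three {A} {d} {e} gap-d gap-e gap-f refl x
  with A x in Ax | A (x ℤ.+ + d) in Ax+d | A (x ℤ.+ + (d + e)) in Ax+f
... | true  | true  | _     = ⊥-elim (gap-d x Ax Ax+d)
... | true  | false | true  = ⊥-elim (gap-f x Ax Ax+f)
... | false | true  | true  = ⊥-elim (gap-e (x ℤ.+ + d) Ax+d (trans (cong A (sym (+-pos-+ x d e))) Ax+f))
... | true  | false | false = s≤s z≤n
... | false | true  | false = s≤s z≤n
... | false | false | true  = s≤s z≤n
... | false | false | false = z≤n

count-triple : ∀ {A d e f} → AvoidsGap A d → AvoidsGap A e → AvoidsGap A f → d + e ≡ f →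
               ∀ t n → count A t n + count A (t ℤ.+ + d) n + count A (t ℤ.+ + f) n ≤ n
count-triple gap-d gap-e gap-f d+e≡f t zero = z≤n
count-triple {A} {d} {e} {f} gap-d gap-e gap-f d+e≡f t (suc n) = begin
  count A t (suc n) + count A (t ℤ.+ + d) (suc n) + count A (t ℤ.+ + f) (suc n)
    ≡⟨ cong₂ (λ y z → (i₀ + c₀) + (indicator (A y) + count A y n) + (indicator (A z) + count A z n))
             (xy∙z≈xz∙y t (+ d) (+ 1)) (xy∙z≈xz∙y t (+ f) (+ 1)) ⟩
  (i₀ + c₀) + (i₁ + c₁) + (i₂ + c₂)
    ≡⟨ interchange i₀ i₁ i₂ c₀ c₁ c₂ ⟩
  (i₀ + i₁ + i₂) + (c₀ + c₁ + c₂)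
    ≤⟨ +-mono-≤ (at-most-one-of-three gap-d gap-e gap-f d+e≡f t₁)
                (count-triple gap-d gap-e gap-f d+e≡f t₁ n) ⟩
  suc n ∎
  where
  open ≤-Reasoning
  t₁ = t ℤ.+ + 1
  i₀ = indicator (A t₁)
  i₁ = indicator (A (t₁ ℤ.+ + d))
  i₂ = indicator (A (t₁ ℤ.+ + f))
  c₀ = count A t₁ n
  c₁ = count A (t₁ ℤ.+ + d) n
  c₂ = count A (t₁ ℤ.+ + f) n
  interchange : ∀ a b c x y z → (a + x) + (b + y) + (c + z) ≡ (a + b + c) + (x + y + z)
  interchange = solve-∀

regroup : ∀ {X p q r s y w v z} → X ≡ p + q → X ≡ r + s →
          2 * (X + y) + (w + v + z) ≡ (p + s + w) + (r + q + y) + (y + v + z)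
regroup {X} {p} {q} {r} {s} {y} {w} {v} {z} X≡p+q X≡r+s = begin
  2 * (X + y) + (w + v + z)               ≡⟨ double X y (w + v + z) ⟩
  (X + y) + (X + y) + (w + v + z)         ≡⟨ cong₂ (λ a b → (a + y) + (b + y) + (w + v + z)) X≡p+q X≡r+s ⟩
  (p + q + y) + (r + s + y) + (w + v + z) ≡⟨ shuffle p q r s y w v z ⟩
  (p + s + w) + (r + q + y) + (y + v + z) ∎
  where
  open ≡-Reasoning
  double : ∀ a b c → 2 * (a + b) + c ≡ (a + b) + (a + b) + c
  double = solve-∀
  shuffle : ∀ p q r s y w v z → (p + q + y) + (r + s + y) + (w + v + z) ≡ (p + s + w) + (r + q + y) + (y + v + z)
  shuffle = solve-∀

module _ {λ₁ λ₂ : ℕ} {A : SubsetZ} (packing : Packing (S₃ λ₁ λ₂) A) (1≤λ₁ : 1 ≤ λ₁) (1≤λ₂ : 1 ≤ λ₂) where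

  private
    gap-λ₁ : AvoidsGap A λ₁
    gap-λ₁ = packing⇒avoidsGap packing (there (here refl)) (here refl) refl 1≤λ₁

    gap-λ₂ : AvoidsGap A λ₂
    gap-λ₂ = packing⇒avoidsGap packing (there (there (here refl))) (there (here refl)) (ℤ.pos-+ λ₁ λ₂) 1≤λ₂

    gap-λ₁+λ₂ : AvoidsGap A (λ₁ + λ₂)
    gap-λ₁+λ₂ = packing⇒avoidsGap packing (there (there (here refl))) (here refl) refl (≤-trans 1≤λ₁ (m≤m+n λ₁ λ₂))

  packing-count-bound : ∀ t → 2 * count A t (2 * λ₁ + λ₂) + count A (t ℤ.+ + (λ₁ + λ₂)) (2 * λ₁ + λ₂) ≤ 2 * λ₁ + λ₂
  packing-count-bound t = begin
    2 * count A t (2 * λ₁ + λ₂) + count A u (2 * λ₁ + λ₂)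
      ≡⟨ cong₂ (λ c c' → 2 * c + c') I₁-split I₂-split ⟩
    2 * (count A t (λ₁ + λ₂) + y) + (w + v + z)
      ≡⟨ regroup {p = p} {q} {r} {s} {w = w} {v} head-split₂₁ head-split₁₂ ⟩
    (p + s + w) + (r + q + y) + (y + v + z)
      ≤⟨ +-mono-≤ (+-mono-≤ windows-λ₂ windows-λ₁) windows-u ⟩
    λ₂ + λ₁ + λ₁
      ≡⟨ sym 2λ₁+λ₂≡λ₂+λ₁+λ₁ ⟩
    2 * λ₁ + λ₂ ∎
    where
    open ≤-Reasoning
    u = t ℤ.+ + (λ₁ + λ₂)
    p = count A t λ₂
    q = count A (t ℤ.+ + λ₂) λ₁
    r = count A t λ₁
    s = count A (t ℤ.+ + λ₁) λ₂
    y = count A u λ₁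
    w = count A u λ₂
    v = count A (u ℤ.+ + λ₂) λ₁
    z = count A (u ℤ.+ + (λ₁ + λ₂)) λ₁
    2λ₁+λ₂≡λ₁+λ₂+λ₁ : 2 * λ₁ + λ₂ ≡ λ₁ + λ₂ + λ₁
    2λ₁+λ₂≡λ₁+λ₂+λ₁ = solve (λ₁ ∷ λ₂ ∷ [])
    2λ₁+λ₂≡λ₂+λ₁+λ₁ : 2 * λ₁ + λ₂ ≡ λ₂ + λ₁ + λ₁
    2λ₁+λ₂≡λ₂+λ₁+λ₁ = solve (λ₁ ∷ λ₂ ∷ [])
    I₁-split : count A t (2 * λ₁ + λ₂) ≡ count A t (λ₁ + λ₂) + y
    I₁-split = trans (cong (count A t) 2λ₁+λ₂≡λ₁+λ₂+λ₁) (count-+ A t (λ₁ + λ₂) λ₁)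
    I₂-split : count A u (2 * λ₁ + λ₂) ≡ w + v + z
    I₂-split = begin-equality
      count A u (2 * λ₁ + λ₂)
        ≡⟨ cong (count A u) 2λ₁+λ₂≡λ₂+λ₁+λ₁ ⟩
      count A u (λ₂ + λ₁ + λ₁)
        ≡⟨ count-+ A u (λ₂ + λ₁) λ₁ ⟩
      count A u (λ₂ + λ₁) + count A (u ℤ.+ + (λ₂ + λ₁)) λ₁
        ≡⟨ cong₂ _+_ (count-+ A u λ₂ λ₁) (cong (λ k → count A (u ℤ.+ + k) λ₁) (+-comm λ₂ λ₁)) ⟩
      w + v + z ∎
    head-split₂₁ : count A t (λ₁ + λ₂) ≡ p + q
    head-split₂₁ = trans (cong (count A t) (+-comm λ₁ λ₂)) (count-+ A t λ₂ λ₁)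
    head-split₁₂ : count A t (λ₁ + λ₂) ≡ r + s
    head-split₁₂ = count-+ A t λ₁ λ₂
    windows-λ₂ : p + s + w ≤ λ₂
    windows-λ₂ = count-triple gap-λ₁ gap-λ₂ gap-λ₁+λ₂ refl t λ₂
    windows-λ₁ : r + q + y ≤ λ₁
    windows-λ₁ = count-triple gap-λ₂ gap-λ₁ gap-λ₁+λ₂ (+-comm λ₂ λ₁) t λ₁
    windows-u : y + v + z ≤ λ₁
    windows-u = count-triple gap-λ₂ gap-λ₁ gap-λ₁+λ₂ (+-comm λ₂ λ₁) u λ₁

complement-bound : ∀ {c₁ m₁ c₂ m₂ n} → c₁ + m₁ ≡ n → c₂ + m₂ ≡ n →
                   2 * c₁ + c₂ ≤ n → 2 * n ≤ 2 * m₁ + m₂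
complement-bound {c₁} {m₁} {c₂} {m₂} {n} c₁+m₁≡n c₂+m₂≡n 2c₁+c₂≤n = +-cancelˡ-≤ n _ _ (begin
  n + 2 * n                     ≡⟨ +-comm n (2 * n) ⟩
  2 * n + n                     ≡⟨ cong₂ (λ x y → 2 * x + y) (sym c₁+m₁≡n) (sym c₂+m₂≡n) ⟩
  2 * (c₁ + m₁) + (c₂ + m₂)     ≡⟨ solve (c₁ ∷ m₁ ∷ c₂ ∷ m₂ ∷ []) ⟩
  (2 * c₁ + c₂) + (2 * m₁ + m₂) ≤⟨ +-monoˡ-≤ (2 * m₁ + m₂) 2c₁+c₂≤n ⟩
  n + (2 * m₁ + m₂)             ∎)
  where open ≤-Reasoning

proposition5 : (λ₁ λ₂ : ℕ) → 1 ≤ λ₁ → 1 ≤ λ₂ → Coprime λ₁ λ₂ →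
    λ₁ % 3 ≡ (λ₂ ∸ 1) % 3 →
    (A : SubsetZ) → Packing (S₃ λ₁ λ₂) A →
    (t : ℤ) →
    4 * λ₁ + 2 * λ₂ ≤ 2 * missing (I₁ λ₁ λ₂ t) A + missing (I₂ λ₁ λ₂ t) A
proposition5 λ₁ λ₂ 1≤λ₁ 1≤λ₂ _ _ A packing t = begin
  4 * λ₁ + 2 * λ₂     ≡⟨ solve (λ₁ ∷ λ₂ ∷ []) ⟩
  2 * (2 * λ₁ + λ₂)   ≤⟨ complement-bound {m₁ = m₁} {m₂ = m₂} (count+missing A t (2 * λ₁ + λ₂)) I₂-complement
                           (packing-count-bound packing 1≤λ₁ 1≤λ₂ t) ⟩
  2 * m₁ + m₂         ∎
  where
  open ≤-Reasoning
  u = t ℤ.+ + (λ₁ + λ₂)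
  m₁ = missing (I₁ λ₁ λ₂ t) A
  m₂ = missing (I₂ λ₁ λ₂ t) A
  length-I₂ : (3 * λ₁ + 2 * λ₂) ∸ (λ₁ + λ₂) ≡ 2 * λ₁ + λ₂
  length-I₂ = trans (cong (_∸ (λ₁ + λ₂)) end-I₂) (m+n∸n≡m (2 * λ₁ + λ₂) (λ₁ + λ₂))
    where
    end-I₂ : 3 * λ₁ + 2 * λ₂ ≡ (2 * λ₁ + λ₂) + (λ₁ + λ₂)
    end-I₂ = solve (λ₁ ∷ λ₂ ∷ [])
  I₂-complement : count A u (2 * λ₁ + λ₂) + m₂ ≡ 2 * λ₁ + λ₂
  I₂-complement rewrite length-I₂ = count+missing A u (2 * λ₁ + λ₂)
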